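{- Let $F$ be a DeMorgan circuit computing a Boolean function $f:\{0,1\}^n\to\{0,1\}$. If $F$ has no $0$-hazards, then the monotone version $F^+$ of $F$ computes the upwards closure $f^{\uparrow}$ of $f$.
   Context: A DeMorgan circuit on $x_1,\dots,x_n$ has fan-in-2 AND/OR gates and inputs $0,1,x_i,\bar x_i$. Ternary logic: on $\{0,\mathfrak u,1\}$ (with $\mathfrak u=1/2$) AND is $\min$, OR is $\max$, NOT is $1-x$; so a circuit computes a function on $\{0,\mathfrak u,1\}^n$. A resolution of $\alpha\in\{0,\mathfrak u,1\}^n$ replaces each $\mathfrak u$ by $0$ or $1$; $S_\alpha$ is the set of resolutions. $F$ has a $0$-hazard at $\alpha$ if $F(a)=0$ for all $a\in S_\alpha$ but $F(\alpha)=\mathfrak u$. The upwards closure is $f^{\uparrow}(x)=\bigvee_{z\le x}f(z)$ (componentwise order). The monotone version $F^+$ is the monotone circuit obtained from $F$ by replacing every negated input literal $\bar x_i$ with the constant $1$. -}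

module Defs where

open import Data.Nat using (ℕ)
open import Data.Fin using (Fin)
open import Data.Bool using (Bool; true; false)
open import Data.Product using (_×_; ∃-syntax)
open import Data.Sum using (_⊎_)
open import Relation.Binary.PropositionalEquality using (_≡_)
open import Relation.Nullary using (¬_)

-- Ternary values {0, u, 1}, ordered 0 < u < 1
data Tern : Set where
  𝟘 𝕦 𝟙 : Tern

_∧₃_ : Tern → Tern → Tern
𝟘 ∧₃ y = 𝟘
𝕦 ∧₃ 𝟘 = 𝟘
𝕦 ∧₃ y = 𝕦
𝟙 ∧₃ y = y

_∨₃_ : Tern → Tern → Tern
𝟘 ∨₃ y = y
𝕦 ∨₃ 𝟙 = 𝟙
𝕦 ∨₃ y = 𝕦
𝟙 ∨₃ y = 𝟙

¬₃ : Tern → Tern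
¬₃ 𝟘 = 𝟙
¬₃ 𝕦 = 𝕦
¬₃ 𝟙 = 𝟘

⌜_⌝ : Bool → Tern
⌜ false ⌝ = 𝟘
⌜ true ⌝ = 𝟙

-- DeMorgan circuits (as formula-trees over gates; sharing does not affect
-- the function computed) on variables x_0 .. x_{n-1}
data Circuit (n : ℕ) : Set where
  c0 c1 : Circuit n
  pos   : Fin n → Circuit n
  neg   : Fin n → Circuit n
  and   : Circuit n → Circuit n → Circuit n
  or    : Circuit n → Circuit n → Circuit n

eval : ∀ {n} → Circuit n → (Fin n → Tern) → Tern
eval c0 α = 𝟘
eval c1 α = 𝟙
eval (pos i) α = α i
eval (neg i) α = ¬₃ (α i)
eval (and F G) α = eval F α ∧₃ eval G α
eval (or F G) α = eval F α ∨₃ eval G α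

_⁺ : ∀ {n} → Circuit n → Circuit n
c0 ⁺ = c0
c1 ⁺ = c1
pos i ⁺ = pos i
neg i ⁺ = c1
and F G ⁺ = and (F ⁺) (G ⁺)
or F G ⁺ = or (F ⁺) (G ⁺)

embed : ∀ {n} → (Fin n → Bool) → (Fin n → Tern)
embed a i = ⌜ a i ⌝

Computes : ∀ {n} → Circuit n → ((Fin n → Bool) → Bool) → Set
Computes F f = ∀ a → eval F (embed a) ≡ ⌜ f a ⌝

Resolution : ∀ {n} → (Fin n → Bool) → (Fin n → Tern) → Set
Resolution a α = ∀ i → (α i ≡ 𝕦) ⊎ (⌜ a i ⌝ ≡ α i)

ZeroHazard : ∀ {n} → Circuit n → (Fin n → Tern) → Set
ZeroHazard F α = (∀ a → Resolution a α → eval F (embed a) ≡ 𝟘) × (eval F α ≡ 𝕦)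

NoZeroHazards : ∀ {n} → Circuit n → Set
NoZeroHazards F = ∀ α → ¬ ZeroHazard F α

data _≤ᵇ_ : Bool → Bool → Set where
  f≤b : ∀ {b} → false ≤ᵇ b
  t≤t : true ≤ᵇ true

_≼_ : ∀ {n} → (Fin n → Bool) → (Fin n → Bool) → Set
z ≼ x = ∀ i → z i ≤ᵇ x i

UpClosureTrue : ∀ {n} → ((Fin n → Bool) → Bool) → (Fin n → Bool) → Set
UpClosureTrue f x = ∃[ z ] (z ≼ x × f z ≡ true)

ComputesUpClosure : ∀ {n} → Circuit n → ((Fin n → Bool) → Bool) → Set
ComputesUpClosure G f = ∀ x →
  (UpClosureTrue f x × eval G (embed x) ≡ 𝟙) ⊎ (¬ UpClosureTrue f x × eval G (embed x) ≡ 𝟘)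

-- Fix x ∈ {0,1}ⁿ and let α = x/2, i.e. every 1 of x becomes 𝕦, so that the
-- resolutions of α are exactly the z ≤ x. Evaluating F at α and rounding up
-- gives F⁺(x): a negated literal sees ¬(x_i/2) ∈ {𝕦, 1}, which rounds to 1,
-- and rounding up commutes with min and max. Ternary evaluation is monotone
-- in the information order (𝕦 below 0 and 1), so F(α) is 𝕦 or the common
-- value of F on S_α. If f(z) = 1 for some z ≤ x, then F(α) ≠ 0 and F⁺(x) = 1.
-- Otherwise F vanishes on S_α, so F(α) ∈ {0, 𝕦}, and hazard-freeness rules
-- out 𝕦; hence F⁺(x) = ⌈0⌉ = 0.
module Submission where

open import Defs
open import Data.Nat using (ℕ)
open import Data.Fin using (Fin)
open import Data.Fin.Properties using (all?)
open import Data.Fin.Subset.Properties using (anySubset?)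
open import Data.Bool using (Bool; true; false)
open import Data.Vec using (lookup; tabulate)
open import Data.Vec.Properties using (lookup∘tabulate)
open import Data.Empty using (⊥-elim)
open import Data.Product using (_×_; _,_; ∃; ∃-syntax)
open import Data.Sum using (_⊎_; inj₁; inj₂)
open import Function using (_∘_)
open import Relation.Binary.PropositionalEquality
  using (_≡_; _≢_; _≗_; refl; sym; trans; cong; cong₂; subst)
open import Relation.Nullary using (¬_; Dec; yes; no; map′; _×-dec_)
open import Relation.Unary using (Pred; Decidable)

infix 4 _⊑_

data _⊑_ : Tern → Tern → Set where
  𝕦⊑    : ∀ {t} → 𝕦 ⊑ t
  ⊑-refl : ∀ {t} → t ⊑ t

¬₃-mono : ∀ {a b} → a ⊑ b → ¬₃ a ⊑ ¬₃ b
¬₃-mono 𝕦⊑    = 𝕦⊑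
¬₃-mono ⊑-refl = ⊑-refl

∧₃-mono : ∀ {a b c d} → a ⊑ b → c ⊑ d → a ∧₃ c ⊑ b ∧₃ d
∧₃-mono               ⊑-refl ⊑-refl = ⊑-refl
∧₃-mono               𝕦⊑    𝕦⊑    = 𝕦⊑
∧₃-mono {b = 𝟘} {𝟘}   𝕦⊑    ⊑-refl = ⊑-refl
∧₃-mono {b = 𝕦} {𝟘}   𝕦⊑    ⊑-refl = ⊑-refl
∧₃-mono {b = 𝟙} {𝟘}   𝕦⊑    ⊑-refl = ⊑-refl
∧₃-mono {c = 𝕦}       𝕦⊑    ⊑-refl = 𝕦⊑
∧₃-mono {c = 𝟙}       𝕦⊑    ⊑-refl = 𝕦⊑
∧₃-mono {𝟘}           ⊑-refl 𝕦⊑    = ⊑-refl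
∧₃-mono {𝕦}           ⊑-refl 𝕦⊑    = 𝕦⊑
∧₃-mono {𝟙}           ⊑-refl 𝕦⊑    = 𝕦⊑

∨₃-mono : ∀ {a b c d} → a ⊑ b → c ⊑ d → a ∨₃ c ⊑ b ∨₃ d
∨₃-mono               ⊑-refl ⊑-refl = ⊑-refl
∨₃-mono               𝕦⊑    𝕦⊑    = 𝕦⊑
∨₃-mono {b = 𝟘} {𝟙}   𝕦⊑    ⊑-refl = ⊑-refl
∨₃-mono {b = 𝕦} {𝟙}   𝕦⊑    ⊑-refl = ⊑-refl
∨₃-mono {b = 𝟙} {𝟙}   𝕦⊑    ⊑-refl = ⊑-refl
∨₃-mono {c = 𝟘}       𝕦⊑    ⊑-refl = 𝕦⊑
∨₃-mono {c = 𝕦}       𝕦⊑    ⊑-refl = 𝕦⊑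
∨₃-mono {𝟘}           ⊑-refl 𝕦⊑    = 𝕦⊑
∨₃-mono {𝕦}           ⊑-refl 𝕦⊑    = 𝕦⊑
∨₃-mono {𝟙}           ⊑-refl 𝕦⊑    = ⊑-refl

⊑𝟘⇒≡𝟘 : ∀ {t} → t ⊑ 𝟘 → t ≢ 𝕦 → t ≡ 𝟘
⊑𝟘⇒≡𝟘 𝕦⊑    t≢𝕦 = ⊥-elim (t≢𝕦 refl)
⊑𝟘⇒≡𝟘 ⊑-refl _   = refl

eval-mono : ∀ {n} (F : Circuit n) {α β : Fin n → Tern} →
            (∀ i → α i ⊑ β i) → eval F α ⊑ eval F β
eval-mono c0        α⊑β = ⊑-refl
eval-mono c1        α⊑β = ⊑-refl
eval-mono (pos i)   α⊑β = α⊑β i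
eval-mono (neg i)   α⊑β = ¬₃-mono (α⊑β i)
eval-mono (and F G) α⊑β = ∧₃-mono (eval-mono F α⊑β) (eval-mono G α⊑β)
eval-mono (or F G)  α⊑β = ∨₃-mono (eval-mono F α⊑β) (eval-mono G α⊑β)

eval-cong : ∀ {n} (F : Circuit n) {α β : Fin n → Tern} → α ≗ β → eval F α ≡ eval F β
eval-cong c0        α≗β = refl
eval-cong c1        α≗β = refl
eval-cong (pos i)   α≗β = α≗β i
eval-cong (neg i)   α≗β = cong ¬₃ (α≗β i)
eval-cong (and F G) α≗β = cong₂ _∧₃_ (eval-cong F α≗β) (eval-cong G α≗β)
eval-cong (or F G)  α≗β = cong₂ _∨₃_ (eval-cong F α≗β) (eval-cong G α≗β)

resolves⇒⊑ : ∀ {s t} → (s ≡ 𝕦) ⊎ (t ≡ s) → s ⊑ t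
resolves⇒⊑ (inj₁ refl) = 𝕦⊑
resolves⇒⊑ (inj₂ refl) = ⊑-refl

eval-⊑-resolution : ∀ {n} (F : Circuit n) {a α} → Resolution a α → eval F α ⊑ eval F (embed a)
eval-⊑-resolution F res = eval-mono F (resolves⇒⊑ ∘ res)

resolve₀ : Tern → Bool
resolve₀ 𝟙 = true
resolve₀ _ = false

resolve₀-resolution : ∀ {n} (α : Fin n → Tern) → Resolution (resolve₀ ∘ α) α
resolve₀-resolution α i = resolves (α i)
  where
  resolves : ∀ t → (t ≡ 𝕦) ⊎ (⌜ resolve₀ t ⌝ ≡ t)
  resolves 𝟘 = inj₂ refl
  resolves 𝕦 = inj₁ refl
  resolves 𝟙 = inj₂ refl

hazardFree⇒eval≡𝟘 : ∀ {n} (F : Circuit n) → NoZeroHazards F → ∀ α →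
                    (∀ a → Resolution a α → eval F (embed a) ≡ 𝟘) → eval F α ≡ 𝟘
hazardFree⇒eval≡𝟘 F noHazard α vanishes =
  ⊑𝟘⇒≡𝟘 (subst (eval F α ⊑_) (vanishes _ res₀) (eval-⊑-resolution F res₀))
         (λ F[α]≡𝕦 → noHazard α (vanishes , F[α]≡𝕦))
  where
  res₀ = resolve₀-resolution α

half : Bool → Tern
half true  = 𝕦
half false = 𝟘

⌈_⌉ : Tern → Tern
⌈ 𝟘 ⌉ = 𝟘
⌈ 𝕦 ⌉ = 𝟙
⌈ 𝟙 ⌉ = 𝟙

⌈⌉-∧₃ : ∀ a b → ⌈ a ∧₃ b ⌉ ≡ ⌈ a ⌉ ∧₃ ⌈ b ⌉
⌈⌉-∧₃ 𝟘 b = refl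
⌈⌉-∧₃ 𝕦 𝟘 = refl
⌈⌉-∧₃ 𝕦 𝕦 = refl
⌈⌉-∧₃ 𝕦 𝟙 = refl
⌈⌉-∧₃ 𝟙 b = refl

⌈⌉-∨₃ : ∀ a b → ⌈ a ∨₃ b ⌉ ≡ ⌈ a ⌉ ∨₃ ⌈ b ⌉
⌈⌉-∨₃ 𝟘 b = refl
⌈⌉-∨₃ 𝕦 𝟘 = refl
⌈⌉-∨₃ 𝕦 𝕦 = refl
⌈⌉-∨₃ 𝕦 𝟙 = refl
⌈⌉-∨₃ 𝟙 b = refl

⌈half⌉ : ∀ b → ⌈ half b ⌉ ≡ ⌜ b ⌝
⌈half⌉ true  = refl
⌈half⌉ false = refl

⌈¬₃half⌉ : ∀ b → ⌈ ¬₃ (half b) ⌉ ≡ 𝟙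
⌈¬₃half⌉ true  = refl
⌈¬₃half⌉ false = refl

⌈⌉-⊑𝟙 : ∀ {t} → t ⊑ 𝟙 → ⌈ t ⌉ ≡ 𝟙
⌈⌉-⊑𝟙 𝕦⊑    = refl
⌈⌉-⊑𝟙 ⊑-refl = refl

eval-⁺ : ∀ {n} (F : Circuit n) x → eval (F ⁺) (embed x) ≡ ⌈ eval F (half ∘ x) ⌉
eval-⁺ c0        x = refl
eval-⁺ c1        x = refl
eval-⁺ (pos i)   x = sym (⌈half⌉ (x i))
eval-⁺ (neg i)   x = sym (⌈¬₃half⌉ (x i))
eval-⁺ (and F G) x = trans (cong₂ _∧₃_ (eval-⁺ F x) (eval-⁺ G x))
                           (sym (⌈⌉-∧₃ (eval F (half ∘ x)) (eval G (half ∘ x))))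
eval-⁺ (or F G)  x = trans (cong₂ _∨₃_ (eval-⁺ F x) (eval-⁺ G x))
                           (sym (⌈⌉-∨₃ (eval F (half ∘ x)) (eval G (half ∘ x))))

≼⇒resolution-half : ∀ {n} {z x : Fin n → Bool} → z ≼ x → Resolution z (half ∘ x)
≼⇒resolution-half z≼x i = resolves (z≼x i)
  where
  resolves : ∀ {b c} → b ≤ᵇ c → (half c ≡ 𝕦) ⊎ (⌜ b ⌝ ≡ half c)
  resolves {c = true}  f≤b = inj₁ refl
  resolves {c = false} f≤b = inj₂ refl
  resolves             t≤t = inj₁ refl

resolution-half⇒≼ : ∀ {n} {z x : Fin n → Bool} → Resolution z (half ∘ x) → z ≼ x
resolution-half⇒≼ {z = z} {x} res i = below (z i) (x i) (res i)
  where
  below : ∀ b c → (half c ≡ 𝕦) ⊎ (⌜ b ⌝ ≡ half c) → b ≤ᵇ c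
  below false c     _        = f≤b
  below true  true  _        = t≤t
  below true  false (inj₁ ())
  below true  false (inj₂ ())

-- Without function extensionality the enumerated lookup (tabulate a) only agrees
-- with a pointwise, hence the hypothesis that P respects ≗.
anyBoolVector? : ∀ {n ℓ} {P : Pred (Fin n → Bool) ℓ} →
                 (∀ {a b} → a ≗ b → P a → P b) → Decidable P → Dec (∃ P)
anyBoolVector? P-resp P? =
  map′ (λ (v , Pv) → lookup v , Pv)
       (λ (a , Pa) → tabulate a , P-resp (sym ∘ lookup∘tabulate a) Pa)
       (anySubset? (P? ∘ lookup))

≤ᵇ? : ∀ b c → Dec (b ≤ᵇ c)
≤ᵇ? false c     = yes f≤b
≤ᵇ? true  true  = yes t≤t
≤ᵇ? true  false = no λ ()

≟𝟙 : ∀ t → Dec (t ≡ 𝟙)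
≟𝟙 𝟘 = no λ ()
≟𝟙 𝕦 = no λ ()
≟𝟙 𝟙 = yes refl

oneBelow? : ∀ {n} (F : Circuit n) x → Dec (∃[ z ] z ≼ x × eval F (embed z) ≡ 𝟙)
oneBelow? F x = anyBoolVector? respects (λ z → all? (λ i → ≤ᵇ? (z i) (x i)) ×-dec ≟𝟙 _)
  where
  respects : ∀ {a b} → a ≗ b → a ≼ x × eval F (embed a) ≡ 𝟙 → b ≼ x × eval F (embed b) ≡ 𝟙
  respects a≗b (a≼x , Fa≡𝟙) =
    (λ i → subst (_≤ᵇ x _) (a≗b i) (a≼x i)) ,
    trans (sym (eval-cong F (cong ⌜_⌝ ∘ a≗b))) Fa≡𝟙

⌜⌝≡𝟙 : ∀ b → ⌜ b ⌝ ≡ 𝟙 → b ≡ true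
⌜⌝≡𝟙 true  _ = refl

⌜⌝≢𝟙 : ∀ b → ⌜ b ⌝ ≢ 𝟙 → ⌜ b ⌝ ≡ 𝟘
⌜⌝≢𝟙 true  ≢𝟙 = ⊥-elim (≢𝟙 refl)
⌜⌝≢𝟙 false _  = refl

theorem1 : (n : ℕ) (F : Circuit n) (f : (Fin n → Bool) → Bool) →
    Computes F f → NoZeroHazards F → ComputesUpClosure (F ⁺) f
theorem1 n F f computes noHazard x with oneBelow? F x
... | yes (z , z≼x , Fz≡𝟙) = inj₁ ((z , z≼x , fz≡true) , F⁺x≡𝟙)
  where
  fz≡true = ⌜⌝≡𝟙 (f z) (trans (sym (computes z)) Fz≡𝟙)
  F⁺x≡𝟙 = trans (eval-⁺ F x)
                (⌈⌉-⊑𝟙 (subst (eval F (half ∘ x) ⊑_) Fz≡𝟙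
                               (eval-⊑-resolution F (≼⇒resolution-half z≼x))))
... | no noneBelow = inj₂ (notUp , F⁺x≡𝟘)
  where
  notUp : ¬ UpClosureTrue f x
  notUp (z , z≼x , fz) = noneBelow (z , z≼x , trans (computes z) (cong ⌜_⌝ fz))
  vanishes : ∀ a → Resolution a (half ∘ x) → eval F (embed a) ≡ 𝟘
  vanishes a res = trans (computes a) (⌜⌝≢𝟙 (f a)
    (λ fa≡𝟙 → noneBelow (a , resolution-half⇒≼ res , trans (computes a) fa≡𝟙)))
  F⁺x≡𝟘 = trans (eval-⁺ F x) (cong ⌈_⌉ (hazardFree⇒eval≡𝟘 F noHazard (half ∘ x) vanishes))
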